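{- Let $G$ be a connected outerplanar graph whose blocks are $B_1,\ldots,B_m$ (so $G$ is the edge-disjoint union of $B_1,\dots,B_m$). Then $\mathrm{lcapt}_2(G) \leq \sum_{i=1}^m (|V(B_i)| - 1)$.
   Context: A block of a graph is a maximal connected subgraph without a cut-vertex. The localization game on a connected graph $G$ with $k$ cops: the robber first chooses a starting vertex (invisible to the cops; the robber knows the cops' strategy). Then rounds are played; in each round the cops choose (probe) any $k$ vertices $c_1,\dots,c_k$ of $G$ and learn $(d(c_1,r),\dots,d(c_k,r))$, where $r$ is the robber's current vertex; then the robber moves to a neighbor or stays put. The cops win if after finitely many rounds they can determine the robber's exact position. The localization number $\zeta(G)$ is the minimum $k$ for which the cops have a winning strategy; for outerplanar graphs $\zeta(G) \le 2$. For $k \geq \zeta(G)$, $\mathrm{lcapt}_k(G)$ is the number of rounds (probes) needed for $k$ cops to determine the robber's location under optimal play (cops minimizing, robber maximizing). -}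

module Defs where

open import Data.Nat using (ℕ; zero; suc; _<_; _≤_; _∸_)
open import Data.Bool using (Bool; true; false; _∧_; _∨_; if_then_else_)
open import Data.Fin using (Fin)
open import Data.Fin.Subset using (Subset; _∈_; _∉_; _⊆_; ∣_∣)
open import Data.Vec using (Vec; []; _∷_; map; _∷ʳ_)
open import Data.List using (List) renaming (map to mapL)
open import Data.Nat.ListAction using (sum)
open import Data.Product using (Σ; ∃; _×_; _,_; proj₁)
open import Data.Empty using (⊥)
open import Data.List.Relation.Unary.Unique.Propositional using (Unique)
open import Data.List.Membership.Propositional using () renaming (_∈_ to _∈L_)
open import Data.Sum using (_⊎_)
open import Relation.Nullary using (¬_; does)
open import Relation.Binary.PropositionalEquality using (_≡_; _≢_)
open import Function.Definitions using (Injective)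
open import Data.Fin using (_≟_)

record Graph (n : ℕ) : Set where
  field
    adj     : Fin n → Fin n → Bool
    symm    : ∀ u v → adj u v ≡ adj v u
    irrefl  : ∀ u → adj u u ≡ false

open Graph public

Adj : ∀ {n} → Graph n → Fin n → Fin n → Set
Adj G u v = adj G u v ≡ true

data ReachIn {n} (G : Graph n) (S : Subset n) : Fin n → Fin n → Set where
  here : ∀ {a} → a ∈ S → ReachIn G S a a
  step : ∀ {a b c} → a ∈ S → Adj G a b → ReachIn G S b c → ReachIn G S a c

ConnectedIn : ∀ {n} → Graph n → Subset n → Set
ConnectedIn G S = (∃ λ a → a ∈ S) ×
                  (∀ a b → a ∈ S → b ∈ S → ReachIn G S a b)

full : ∀ {n} → Subset n
full {zero}  = []
full {suc n} = true ∷ full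

Connected : ∀ {n} → Graph n → Set
Connected G = ConnectedIn G full

_－_ : ∀ {n} → Subset n → Fin n → Subset n
[] － ()
(x ∷ S) － Fin.zero  = false ∷ S
(x ∷ S) － Fin.suc v = x ∷ (S － v)

IsCutVertexIn : ∀ {n} → Graph n → Subset n → Fin n → Set
IsCutVertexIn G S v = v ∈ S × (∃ λ a → ∃ λ b → a ∈ (S － v) × b ∈ (S － v) ×
                                   ¬ ReachIn G (S － v) a b)

TwoConnLike : ∀ {n} → Graph n → Subset n → Set
TwoConnLike G S = ConnectedIn G S × (∀ v → ¬ IsCutVertexIn G S v)

-- a block: maximal connected subgraph without a cut-vertex
-- (maximal such subgraphs are induced, so it is described by its vertex set)
IsBlock : ∀ {n} → Graph n → Subset n → Set
IsBlock G S = TwoConnLike G S × (∀ T → S ⊆ T → TwoConnLike G T → T ≡ S)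

-- Outerplanarity: a drawing with all vertices on a circle (in the cyclic
-- order given by an injective position map) and edges as pairwise
-- non-crossing chords.

Outerplanar : ∀ {n} → Graph n → Set
Outerplanar {n} G =
  Σ (Fin n → ℕ) λ pos → Injective _≡_ _≡_ pos ×
    (∀ a b c d → Adj G a b → Adj G c d →
       pos a < pos c → pos c < pos b → pos b < pos d → ⊥)

anyFin : ∀ {n} → (Fin n → Bool) → Bool
anyFin {zero}  f = false
anyFin {suc n} f = f Fin.zero ∨ anyFin (λ i → f (Fin.suc i))

reach : ∀ {n} → Graph n → ℕ → Fin n → Fin n → Bool
reach G zero    u v = does (u ≟ v)
reach G (suc k) u v = reach G k u v ∨ anyFin (λ w → reach G k u w ∧ adj G w v)

search : (ℕ → Bool) → ℕ → ℕ → ℕ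
search f k zero       = k
search f k (suc fuel) = if f k then k else search f (suc k) fuel

-- graph distance (correct for connected graphs, where d(u,v) ≤ n - 1)
dist : ∀ {n} → Graph n → Fin n → Fin n → ℕ
dist {n} G u v = search (λ k → reach G k u v) 0 n

-- a robber walk: position at the time of the i-th probe (i = 0,1,2,...);
-- between probes the robber moves to a neighbour or stays put
RobberWalk : ∀ {n} → Graph n → Set
RobberWalk {n} G = Σ (ℕ → Fin n) λ w →
  ∀ i → w (suc i) ≡ w i ⊎ Adj G (w i) (w (suc i))

-- a (deterministic, adaptive) cop strategy: given the answers to the first
-- t probes, choose the next k probed vertices
CopStrategy : ℕ → ℕ → Set
CopStrategy n k = (t : ℕ) → Vec (Vec ℕ k) t → Vec (Fin n) k

answers : ∀ {n k} → (G : Graph n) → CopStrategy n k → (ℕ → Fin n) →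
          (t : ℕ) → Vec (Vec ℕ k) t
answers G σ w zero    = []
answers G σ w (suc t) =
  answers G σ w t ∷ʳ map (λ c → dist G c (w t)) (σ t (answers G σ w t))

-- after t probes the cops know the robber's current position, i.e. the
-- position at the time of the last probe (the start vertex if t = 0):
-- every walk giving the same answers is at the same vertex then
LocatedAfter : ∀ {n k} → (G : Graph n) → CopStrategy n k →
               (ℕ → Fin n) → ℕ → Set
LocatedAfter G σ w zero    = ∀ (w' : RobberWalk G) → proj₁ w' 0 ≡ w 0
LocatedAfter G σ w (suc t) = ∀ (w' : RobberWalk G) →
  answers G σ (proj₁ w') (suc t) ≡ answers G σ w (suc t) →
  proj₁ w' t ≡ w t

LcaptAtMost : ∀ {n} → Graph n → (k N : ℕ) → Set
LcaptAtMost {n} G k N = Σ (CopStrategy n k) λ σ →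
  ∀ (w : RobberWalk G) → ∃ λ t → t ≤ N × LocatedAfter G σ (proj₁ w) t

AreTheBlocks : ∀ {n} → Graph n → List (Subset n) → Set
AreTheBlocks G Bs = Unique Bs × (∀ S → (IsBlock G S → S ∈L Bs) × (S ∈L Bs → IsBlock G S))

blockSum : ∀ {n} → List (Subset n) → ℕ
blockSum Bs = sum (mapL (λ S → ∣ S ∣ ∸ 1) Bs)

-- For a connected graph on n vertices, ∑ (|V(Bᵢ)| - 1) ≥ n - 1: grow a vertex set from a single
-- vertex, each time adding the block of an edge leaving the set; the block shares a vertex with
-- the set, so it adds at most |V(B)| - 1 vertices. It therefore suffices for two cops to locate
-- the robber within n - 1 rounds.
--
-- Let v₀, v₁, …, vₙ₋₁ be the vertices in the order of the outerplanar drawing. In round t the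
-- cops probe v₀ and vₜ₊₁. Invariant: if the robber is not located after round t, every candidate
-- lies beyond vₜ₊₁. A chord separates its arc of the circle from the rest, so a shortest path
-- from inside the arc to outside passes through an end of the chord. Let u ≠ w be candidates of
-- round t + 1, equidistant from v₀ and vₜ₊₂, with u before vₜ₊₂. Separation by chords makes u
-- adjacent to every candidate of round t, and then every position of w contradicts either the
-- absence of crossing chords or the distance equalities.
-- After round n - 2 nothing lies beyond vₙ₋₁.

module Submission where

open import Defs
open import Data.Bool using (Bool; true; false; _∧_; _∨_; if_then_else_)
open import Data.Bool.Properties using (∨-zeroʳ) renaming (_≟_ to _≟ᵇ_)
open import Data.Nat using (ℕ; zero; suc; _+_; _∸_; _≤_; _<_; z≤n; s≤s; _≤?_; _<?_) renaming (_≟_ to _≟ℕ_)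
open import Data.Nat.Properties hiding (_≟_)
open import Data.Nat.Induction using (<-rec; <-wellFounded)
open import Induction.WellFounded using (Acc; acc)
open import Data.Fin using (Fin; toℕ; _≟_) renaming (zero to fzero; suc to fsuc)
open import Data.Fin.Properties using (toℕ<n; pigeonhole; any?; all?; ¬∀⟶∃¬) renaming (suc-injective to fsuc-injective)
open import Data.Vec using (Vec; []; _∷_; here; there) renaming (map to mapᵛ; replicate to replicateᵛ)
open import Data.Vec.Properties using (∷-injective; ∷ʳ-injective; ∷ʳ-injectiveʳ) renaming (≡-dec to ≡-decᵛ)
open import Data.Fin.Subset using (Subset; _∈_; _∉_; _⊆_; _⊂_; _⊃_; _∪_; ⁅_⁆; ∣_∣; ⊤; inside; outside)
open import Data.Fin.Subset.Properties
  using (_∈?_; _⊆?_; ⊆-refl; ⊆-trans; ⊆-antisym; x∈⁅x⁆; x∈⁅y⁆⇒x≡y; x∈p∪q⁻; x∈p∪q⁺; p⊆p∪q; q⊆p∪q; p⊆q⇒∣p∣≤∣q∣; ∣⊤∣≡n; ∣⁅x⁆∣≡1)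
open import Data.Fin.Subset.Induction using (⊃-wellFounded)
open import Data.List using (List; []; _∷_) renaming (map to mapˡ)
open import Data.List.Membership.Propositional using () renaming (_∈_ to _∈ˡ_)
open import Data.List.Relation.Unary.Any using (here; there)
open import Data.Nat.ListAction using (sum)
open import Data.Product using (∃; ∃₂; _×_; _,_; proj₁; proj₂)
open import Data.Sum using (_⊎_; inj₁; inj₂; [_,_]′) renaming (map to ⊎-map; map₁ to ⊎-map₁)
open import Data.Empty using (⊥; ⊥-elim)
open import Data.Unit using (tt)
open import Function using (_∘_)
open import Function.Definitions using (Injective)
open import Relation.Nullary using (¬_; Dec; yes; no; does; contradiction; ¬¬-map)
open import Relation.Nullary.Decidable using (_×-dec_; _⊎-dec_; ¬?; decidable-stable; ¬¬-excluded-middle)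
open import Relation.Binary.Definitions using (Tri; tri<; tri≈; tri>)
open import Relation.Binary.PropositionalEquality

anyFin-witness : ∀ {n} (f : Fin n → Bool) → anyFin f ≡ true → ∃ λ i → f i ≡ true
anyFin-witness {suc n} f h with f fzero in f0
... | true  = fzero , f0
... | false = let i , fi = anyFin-witness (f ∘ fsuc) h in fsuc i , fi

anyFin-intro : ∀ {n} (f : Fin n → Bool) i → f i ≡ true → anyFin f ≡ true
anyFin-intro f fzero    fi = cong (_∨ anyFin (f ∘ fsuc)) fi
anyFin-intro f (fsuc i) fi = trans (cong (f fzero ∨_) (anyFin-intro (f ∘ fsuc) i fi)) (∨-zeroʳ (f fzero))

module _ {n} (G : Graph n) where

  Adj-sym : ∀ {u v} → Adj G u v → Adj G v u
  Adj-sym {u} {v} e = trans (symm G v u) e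

  Adj⇒≢ : ∀ {u v} → Adj G u v → u ≢ v
  Adj⇒≢ {u} e refl with trans (sym e) (irrefl G u)
  ... | ()

ClosedNbhd : ∀ {n} → Graph n → (Fin n → Set) → Fin n → Set
ClosedNbhd G C v = ∃ λ x → C x × (x ≡ v ⊎ Adj G x v)

infixl 5 _▷_

data Walk {n} (G : Graph n) (u : Fin n) : Fin n → ℕ → Set where
  nil : Walk G u u 0
  _▷_ : ∀ {v w k} → Walk G u v k → Adj G v w → Walk G u w (suc k)

module _ {n} {G : Graph n} where

  _++_ : ∀ {u v w i j} → Walk G u v i → Walk G v w j → Walk G u w (j + i)
  p ++ nil     = p
  p ++ (q ▷ e) = (p ++ q) ▷ e

  _◁_ : ∀ {u v w k} → Adj G u v → Walk G v w k → Walk G u w (suc k)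
  e ◁ nil     = nil ▷ e
  e ◁ (p ▷ f) = (e ◁ p) ▷ f

  reverse : ∀ {u v k} → Walk G u v k → Walk G v u k
  reverse nil     = nil
  reverse (p ▷ e) = Adj-sym G e ◁ reverse p

  ReachIn⇒Walk : ∀ {S u v} → ReachIn G S u v → ∃ (Walk G u v)
  ReachIn⇒Walk (here _)     = 0 , nil
  ReachIn⇒Walk (step _ e r) = let k , p = ReachIn⇒Walk r in suc k , e ◁ p

  splitAt : ∀ {u v k} → Walk G u v k → ∀ i → i ≤ k →
            ∃₂ λ x j → Walk G u x i × Walk G x v j × i + j ≡ k
  splitAt {v = v} p i i≤k with m≤n⇒m<n∨m≡n i≤k
  splitAt {v = v} p       i i≤k | inj₂ refl = v , 0 , p , nil , +-identityʳ i
  splitAt         (p ▷ e) i i≤k | inj₁ i<k  =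
    let x , j , q , r , i+j≡k = splitAt p i (m<1+n⇒m≤n i<k)
    in x , suc j , q , r ▷ e , trans (+-suc i j) (cong suc i+j≡k)

  walk⇒reach : ∀ {u v k} → Walk G u v k → reach G k u v ≡ true
  walk⇒reach {u} nil with u ≟ u
  ... | yes _  = refl
  ... | no u≢u = ⊥-elim (u≢u refl)
  walk⇒reach {u} {k = suc k} (_▷_ {v} {w} p e) =
    trans (cong (reach G k u w ∨_) (anyFin-intro _ v (cong₂ _∧_ (walk⇒reach p) e)))
          (∨-zeroʳ (reach G k u w))

  reach⇒walk : ∀ k {u v} → reach G k u v ≡ true → ∃ λ j → j ≤ k × Walk G u v j
  reach⇒walk zero {u} {v} h with u ≟ v
  reach⇒walk zero h | yes refl = 0 , z≤n , nil
  reach⇒walk (suc k) {u} {v} h with reach G k u v in r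
  ... | true  = let j , j≤k , p = reach⇒walk k r in j , m≤n⇒m≤1+n j≤k , p
  ... | false with anyFin-witness _ h
  ... | w , h′ with reach G k u w in r′ | adj G w v in e
  ... | true | true = let j , j≤k , p = reach⇒walk k r′ in suc j , s≤s j≤k , p ▷ e

  -- A walk of length at least n visits some vertex twice; cutting out the loop shortens it.
  shorten : ∀ {u v k} → Walk G u v k → ∃ λ j → j < n × Walk G u v j
  shorten {k = k} = <-rec P go k
    where
    P : ℕ → Set
    P k = ∀ {u v} → Walk G u v k → ∃ λ j → j < n × Walk G u v j
    go : ∀ k → (∀ {j} → j < k → P j) → P k
    go k rec {u} p with k <? n
    ... | yes k<n = k , k<n , p
    ... | no k≮n =
      let vertexAt = λ (i : Fin (suc k)) → proj₁ (splitAt p (toℕ i) (m<1+n⇒m≤n (toℕ<n i)))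
          i , j , i<j , same = pigeonhole (s≤s (≮⇒≥ k≮n)) vertexAt
          _ , _ , prefix , _ , _ = splitAt p (toℕ i) (m<1+n⇒m≤n (toℕ<n i))
          _ , l , _ , suffix , j+l≡k = splitAt p (toℕ j) (m<1+n⇒m≤n (toℕ<n j))
          shorter : l + toℕ i < k
          shorter = begin-strict
            l + toℕ i <⟨ +-monoʳ-< l i<j ⟩
            l + toℕ j ≡⟨ +-comm l (toℕ j) ⟩
            toℕ j + l ≡⟨ j+l≡k ⟩
            k         ∎
      in rec shorter (subst (λ x → Walk G u x (toℕ i)) same prefix ++ suffix)
      where open ≤-Reasoning

∈-full : ∀ {n} (v : Fin n) → v ∈ full
∈-full fzero    = here
∈-full (fsuc v) = there (∈-full v)

Connected⇒walks : ∀ {n} {G : Graph n} → Connected G → ∀ u v → ∃ (Walk G u v)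
Connected⇒walks (_ , reach) u v = ReachIn⇒Walk (reach u v (∈-full u) (∈-full v))

search-≤ : ∀ f k fuel → search f k fuel ≤ k + fuel
search-≤ f k zero       = ≤-reflexive (sym (+-identityʳ k))
search-≤ f k (suc fuel) with f k
... | true  = m≤m+n k (suc fuel)
... | false = ≤-trans (search-≤ f (suc k) fuel) (≤-reflexive (sym (+-suc k fuel)))

search-least : ∀ f {k fuel m} → f m ≡ true → k ≤ m → m < k + fuel →
               search f k fuel ≤ m × f (search f k fuel) ≡ true
search-least f {k} {zero} fm k≤m m<k+0 = ⊥-elim (<⇒≱ m<k+0 (≤-trans (≤-reflexive (+-identityʳ k)) k≤m))
search-least f {k} {suc fuel} {m} fm k≤m m<k+fuel with f k in fk
... | true  = k≤m , fk
... | false with m≤n⇒m<n∨m≡n k≤m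
...   | inj₂ refl = contradiction (trans (sym fm) fk) λ ()
...   | inj₁ k<m = search-least f fm k<m (≤-trans m<k+fuel (≤-reflexive (+-suc k fuel)))

module Distance {n} (G : Graph n) (connected : ∀ u v → ∃ (Walk G u v)) where

  d : Fin n → Fin n → ℕ
  d = dist G

  dist-≤-walk : ∀ {u v k} → Walk G u v k → d u v ≤ k
  dist-≤-walk {u} {v} {k} p with k <? n
  ... | yes k<n = proj₁ (search-least (λ i → reach G i u v) (walk⇒reach p) z≤n k<n)
  ... | no k≮n  = ≤-trans (search-≤ (λ i → reach G i u v) 0 n) (≮⇒≥ k≮n)

  geodesic : ∀ u v → Walk G u v (d u v)
  geodesic u v =
    let _ , p      = connected u v
        _ , j<n , q = shorten p
        _ , found  = search-least (λ i → reach G i u v) (walk⇒reach q) z≤n j<n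
        _ , i≤d , r = reach⇒walk {G = G} (d u v) found
    in subst (Walk G u v) (≤-antisym i≤d (dist-≤-walk r)) r

  dist-refl : ∀ u → d u u ≡ 0
  dist-refl u = n≤0⇒n≡0 (dist-≤-walk nil)

  dist≡0⇒≡ : ∀ {u v} → d u v ≡ 0 → u ≡ v
  dist≡0⇒≡ {u} {v} d≡0 = endpoints (subst (Walk G u v) d≡0 (geodesic u v))
    where endpoints : Walk G u v 0 → u ≡ v
          endpoints nil = refl

  dist≤1⇒Adj : ∀ {u v} → u ≢ v → d u v ≤ 1 → Adj G u v
  dist≤1⇒Adj {u} {v} u≢v d≤1 with n≤1⇒n≡0∨n≡1 d≤1
  ... | inj₁ d≡0 = ⊥-elim (u≢v (dist≡0⇒≡ d≡0))
  ... | inj₂ d≡1 = edge (subst (Walk G u v) d≡1 (geodesic u v))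
    where edge : Walk G u v 1 → Adj G u v
          edge (nil ▷ e) = e

  Adj⇒dist≡1 : ∀ {u v} → Adj G u v → d u v ≡ 1
  Adj⇒dist≡1 e with n≤1⇒n≡0∨n≡1 (dist-≤-walk (nil ▷ e))
  ... | inj₁ d≡0 = ⊥-elim (Adj⇒≢ G e (dist≡0⇒≡ d≡0))
  ... | inj₂ d≡1 = d≡1

  dist-sym : ∀ u v → d u v ≡ d v u
  dist-sym u v = ≤-antisym (dist-≤-walk (reverse (geodesic v u))) (dist-≤-walk (reverse (geodesic u v)))

  dist-triangle : ∀ u v w → d u w ≤ d u v + d v w
  dist-triangle u v w = ≤-trans (dist-≤-walk (geodesic u v ++ geodesic v w)) (≤-reflexive (+-comm (d v w) (d u v)))

  dist-step : ∀ s {x y} → Adj G x y → d s y ≤ suc (d s x)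
  dist-step s {x} {y} e = begin
    d s y         ≤⟨ dist-triangle s x y ⟩
    d s x + d x y ≡⟨ cong (d s x +_) (Adj⇒dist≡1 e) ⟩
    d s x + 1     ≡⟨ +-comm (d s x) 1 ⟩
    suc (d s x)   ∎
    where open ≤-Reasoning

  detour-step : ∀ {p z w q L} → Adj G w q → d p z + d z w ≤ L → d p z + d z q ≤ suc L
  detour-step {p} {z} {w} {q} {L} e ≤L = begin
    d p z + d z q       ≤⟨ +-monoʳ-≤ (d p z) (dist-step z e) ⟩
    d p z + suc (d z w) ≡⟨ +-suc (d p z) (d z w) ⟩
    suc (d p z + d z w) ≤⟨ s≤s ≤L ⟩
    suc L               ∎
    where open ≤-Reasoning

  detour-end : ∀ {p q L} → Walk G p q L → d p q + d q q ≤ L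
  detour-end {p} {q} walk = ≤-trans (≤-reflexive (trans (cong (d p q +_) (dist-refl q)) (+-identityʳ (d p q))))
                                    (dist-≤-walk walk)

  Between : Fin n → Fin n → Fin n → Set
  Between s x y = d s y ≡ d s x + d x y

  between-sym : ∀ {s x y} → Between s x y → Between y x s
  between-sym {s} {x} {y} b = begin
    d y s         ≡⟨ dist-sym y s ⟩
    d s y         ≡⟨ b ⟩
    d s x + d x y ≡⟨ cong₂ _+_ (dist-sym s x) (dist-sym x y) ⟩
    d x s + d y x ≡⟨ +-comm (d x s) (d y x) ⟩
    d y x + d x s ∎
    where open ≡-Reasoning

  between-≤ : ∀ {s x y} → Between s x y → d s x ≤ d s y
  between-≤ {s} {x} {y} b = ≤-trans (m≤m+n (d s x) (d x y)) (≤-reflexive (sym b))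

  between-< : ∀ {s x y} → Between s x y → x ≢ y → d s x < d s y
  between-< {s} {x} {y} b x≢y = begin-strict
    d s x         ≡⟨ +-identityʳ (d s x) ⟨
    d s x + 0     <⟨ +-monoʳ-< (d s x) (n≢0⇒n>0 (x≢y ∘ dist≡0⇒≡)) ⟩
    d s x + d x y ≡⟨ b ⟨
    d s y         ∎
    where open ≤-Reasoning

  equidistant-via-neighbour : ∀ {s u x y} → Adj G u x → x ≢ y → u ≢ y → d s x ≡ d s y →
                              Between s u y ⊎ Between s x y → Adj G u y × d s y ≡ suc (d s u)
  equidistant-via-neighbour u~x x≢y u≢y eq (inj₂ b) = ⊥-elim (<-irrefl eq (between-< b x≢y))
  equidistant-via-neighbour {s} {u} {x} {y} u~x x≢y u≢y eq (inj₁ b) =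
    u~y , trans b (trans (cong (d s u +_) (Adj⇒dist≡1 u~y)) (+-comm (d s u) 1))
    where
    du+duy≤du+1 : d s u + d u y ≤ d s u + 1
    du+duy≤du+1 = begin
      d s u + d u y ≡⟨ sym b ⟩
      d s y         ≡⟨ sym eq ⟩
      d s x         ≤⟨ dist-step s u~x ⟩
      suc (d s u)   ≡⟨ +-comm 1 (d s u) ⟩
      d s u + 1     ∎
      where open ≤-Reasoning

    u~y : Adj G u y
    u~y = dist≤1⇒Adj u≢y (+-cancelˡ-≤ (d s u) _ _ du+duy≤du+1)

  equidistant-≢ : ∀ {c x y} → d c x ≡ d c y → x ≢ y → c ≢ x
  equidistant-≢ {c} eq x≢y refl = x≢y (dist≡0⇒≡ (trans (sym eq) (dist-refl c)))

module Outerplanarity {n} (G : Graph n) (connected : ∀ u v → ∃ (Walk G u v))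
  (pos : Fin n → ℕ) (pos-injective : Injective _≡_ _≡_ pos)
  (noncrossing : ∀ a b c e → Adj G a b → Adj G c e → pos a < pos c → pos c < pos b → pos b < pos e → ⊥)
  where

  open Distance G connected

  infix 4 _≺_ _≼_

  _≺_ : Fin n → Fin n → Set
  x ≺ y = pos x < pos y

  _≼_ : Fin n → Fin n → Set
  x ≼ y = pos x ≤ pos y

  ≺⇒≢ : ∀ {x y} → x ≺ y → x ≢ y
  ≺⇒≢ x≺y refl = <-irrefl refl x≺y

  ≼∧≢⇒≺ : ∀ {x y} → x ≼ y → x ≢ y → x ≺ y
  ≼∧≢⇒≺ x≼y x≢y = ≤∧≢⇒< x≼y (x≢y ∘ pos-injective)

  -- The chord c₁c₂ separates the arc between its ends from the rest of the circle, so a walk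
  -- from p on the arc to q off it passes through c₁ or c₂.
  chord-cut : ∀ {c₁ c₂ p q L} → Adj G c₁ c₂ → c₁ ≺ c₂ → c₁ ≼ p → p ≼ c₂ → q ≼ c₁ ⊎ c₂ ≼ q →
              Walk G p q L → ∃ λ z → (z ≡ c₁ ⊎ z ≡ c₂) × d p z + d z q ≤ L
  chord-cut {p = p} _ _ c₁≼p p≼c₂ q-out nil =
    p ,
    ⊎-map (λ p≼c₁ → pos-injective (≤-antisym p≼c₁ c₁≼p)) (λ c₂≼p → pos-injective (≤-antisym p≼c₂ c₂≼p)) q-out ,
    ≤-reflexive (cong₂ _+_ (dist-refl p) (dist-refl p))
  chord-cut {c₁} {c₂} {q = q} c₁~c₂ c₁≺c₂ c₁≼p p≼c₂ q-out (_▷_ {w} walk e)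
    with pos w ≤? pos c₁ | pos c₂ ≤? pos w
  ... | yes w≼c₁ | _ = let z , z∈c , ≤L = chord-cut c₁~c₂ c₁≺c₂ c₁≼p p≼c₂ (inj₁ w≼c₁) walk
                       in z , z∈c , detour-step e ≤L
  ... | no _ | yes c₂≼w = let z , z∈c , ≤L = chord-cut c₁~c₂ c₁≺c₂ c₁≼p p≼c₂ (inj₂ c₂≼w) walk
                          in z , z∈c , detour-step e ≤L
  ... | no w⋠c₁ | no c₂⋠w with q ≟ c₁ | q ≟ c₂
  ...   | yes q≡c₁ | _ = q , inj₁ q≡c₁ , detour-end (walk ▷ e)
  ...   | no _ | yes q≡c₂ = q , inj₂ q≡c₂ , detour-end (walk ▷ e)
  ...   | no q≢c₁ | no q≢c₂ = ⊥-elim (crossing q-out)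
    where
    crossing : q ≼ c₁ ⊎ c₂ ≼ q → ⊥
    crossing (inj₁ q≼c₁) = noncrossing q w c₁ c₂ (Adj-sym G e) c₁~c₂ (≼∧≢⇒≺ q≼c₁ q≢c₁) (≰⇒> w⋠c₁) (≰⇒> c₂⋠w)
    crossing (inj₂ c₂≼q) = noncrossing c₁ c₂ w q c₁~c₂ e (≰⇒> w⋠c₁) (≰⇒> c₂⋠w) (≼∧≢⇒≺ c₂≼q (q≢c₂ ∘ sym))

  chord-geodesic : ∀ {c₁ c₂ p q} → Adj G c₁ c₂ → c₁ ≺ c₂ → c₁ ≼ p → p ≼ c₂ → q ≼ c₁ ⊎ c₂ ≼ q →
                   Between p c₁ q ⊎ Between p c₂ q
  chord-geodesic {p = p} {q} c₁~c₂ c₁≺c₂ c₁≼p p≼c₂ q-out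
    with chord-cut c₁~c₂ c₁≺c₂ c₁≼p p≼c₂ q-out (geodesic p q)
  ... | z , inj₁ refl , ≤d = inj₁ (≤-antisym (dist-triangle p z q) ≤d)
  ... | z , inj₂ refl , ≤d = inj₂ (≤-antisym (dist-triangle p z q) ≤d)

  no-K₂,₂-across : ∀ {p u₁ u₂ v₁ v₂} → Adj G u₁ v₁ → Adj G u₁ v₂ → Adj G u₂ v₁ → Adj G u₂ v₂ →
                   u₁ ≢ u₂ → v₁ ≢ v₂ → u₁ ≼ p → u₂ ≼ p → p ≺ v₁ → p ≺ v₂ → ⊥
  no-K₂,₂-across {u₁ = u₁} {u₂} {v₁} {v₂} e₁₁ e₁₂ e₂₁ e₂₂ u₁≢u₂ v₁≢v₂ u₁≼p u₂≼p p≺v₁ p≺v₂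
    with <-cmp (pos u₁) (pos u₂) | <-cmp (pos v₁) (pos v₂)
  ... | tri≈ _ eq _ | _           = u₁≢u₂ (pos-injective eq)
  ... | _           | tri≈ _ eq _ = v₁≢v₂ (pos-injective eq)
  ... | tri< u₁≺u₂ _ _ | tri< v₁≺v₂ _ _ = noncrossing u₁ v₁ u₂ v₂ e₁₁ e₂₂ u₁≺u₂ (≤-<-trans u₂≼p p≺v₁) v₁≺v₂
  ... | tri< u₁≺u₂ _ _ | tri> _ _ v₂≺v₁ = noncrossing u₁ v₂ u₂ v₁ e₁₂ e₂₁ u₁≺u₂ (≤-<-trans u₂≼p p≺v₂) v₂≺v₁
  ... | tri> _ _ u₂≺u₁ | tri< v₁≺v₂ _ _ = noncrossing u₂ v₁ u₁ v₂ e₂₁ e₁₂ u₂≺u₁ (≤-<-trans u₁≼p p≺v₁) v₁≺v₂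
  ... | tri> _ _ u₂≺u₁ | tri> _ _ v₂≺v₁ = noncrossing u₂ v₂ u₁ v₁ e₂₂ e₁₁ u₂≺u₁ (≤-<-trans u₁≼p p≺v₂) v₂≺v₁

  -- One round of the strategy: a and p were probed last, a and b are probed next, and C is the
  -- current candidate set.
  module CandidateStep (a p b : Fin n) (a-leftmost : ∀ v → a ≼ v) (b-next : ∀ {y} → p ≺ y → b ≼ y)
    (C : Fin n → Set) (C-beyond : ∀ {x} → C x → p ≺ x)
    (C-twins-a : ∀ {x y} → C x → C y → d a x ≡ d a y)
    (C-twins-p : ∀ {x y} → C x → C y → d p x ≡ d p y)
    (C-partner : ∀ {x} → C x → ∃ λ y → C y × x ≢ y)
    where

    before-b⇒≼p : ∀ {u} → u ≺ b → u ≼ p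
    before-b⇒≼p {u} u≺b with pos u ≤? pos p
    ... | yes u≼p = u≼p
    ... | no u⋠p  = ⊥-elim (<⇒≱ u≺b (b-next (≰⇒> u⋠p)))

    neighbour-of-twin : ∀ {u x y} → C x → C y → x ≢ y → Adj G u x → u ≼ p → Adj G u y × d a y ≡ suc (d a u)
    neighbour-of-twin {u} {x} {y} cx cy x≢y u~x u≼p with <-cmp (pos x) (pos y)
    ... | tri≈ _ eq _  = ⊥-elim (x≢y (pos-injective eq))
    ... | tri< x≺y _ _ =
      let u≺y = ≤-<-trans u≼p (C-beyond cy)
          u~y , _ = equidistant-via-neighbour u~x x≢y (≺⇒≢ u≺y) (C-twins-p cx cy)
                      (chord-geodesic u~x u≺x u≼p (<⇒≤ (C-beyond cx)) (inj₂ (<⇒≤ x≺y)))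
          _ , dax = equidistant-via-neighbour u~y (x≢y ∘ sym) (≺⇒≢ u≺x) (C-twins-a cy cx)
                      (⊎-map between-sym between-sym
                        (chord-geodesic u~y u≺y (<⇒≤ u≺x) (<⇒≤ x≺y) (inj₁ (a-leftmost u))))
      in u~y , trans (C-twins-a cy cx) dax
      where u≺x = ≤-<-trans u≼p (C-beyond cx)
    ... | tri> _ _ y≺x =
      equidistant-via-neighbour u~x x≢y (≺⇒≢ (≤-<-trans u≼p (C-beyond cy))) (C-twins-a cx cy)
        (⊎-map between-sym between-sym
          (chord-geodesic u~x (≤-<-trans u≼p (C-beyond cx)) (≤-trans u≼p (<⇒≤ (C-beyond cy))) (<⇒≤ y≺x)
                          (inj₁ (a-leftmost u))))

    Hub : Fin n → Set
    Hub u = ∀ {z} → C z → Adj G u z × d a z ≡ suc (d a u)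

    near∧≼p⇒hub : ∀ {u} → ClosedNbhd G C u → u ≼ p → Hub u
    near∧≼p⇒hub (x , cx , inj₁ refl) u≼p _ = ⊥-elim (<⇒≱ (C-beyond cx) u≼p)
    near∧≼p⇒hub {u} (x , cx , inj₂ x~u) u≼p {z} cz with z ≟ x
    ... | no z≢x   = neighbour-of-twin cx cz (z≢x ∘ sym) (Adj-sym G x~u) u≼p
    ... | yes refl = let y , cy , x≢y = C-partner cx
                         _ , day = neighbour-of-twin cx cy x≢y (Adj-sym G x~u) u≼p
                     in Adj-sym G x~u , trans (C-twins-a cx cy) day

    hub-twin-closer : ∀ {u w c} → Hub u → d a u ≡ d a w → C c → d a w < d a c
    hub-twin-closer u-hub au cc = ≤-reflexive (trans (cong suc (sym au)) (sym (proj₂ (u-hub cc))))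

    ¬hub-twin-beyond-b : ∀ {u w x} → u ≺ b → b ≺ w → Hub u → C x → Adj G w x →
                         d a u ≡ d a w → d b u ≡ d b w → u ≢ w → ⊥
    ¬hub-twin-beyond-b {u} {w} {x} u≺b b≺w u-hub cx w~x au bu u≢w = <⇒≱ bx<bu bu≤bx
      where
      C-before-w : ∀ {c} → C c → c ≺ w
      C-before-w {c} cc with <-cmp (pos c) (pos w)
      ... | tri< c≺w _ _ = c≺w
      ... | tri≈ _ eq _  = ⊥-elim (<-irrefl (cong (d a) (sym (pos-injective eq))) (hub-twin-closer u-hub au cc))
      ... | tri> _ _ w≺c with chord-geodesic (proj₁ (u-hub cc)) (<-trans (<-trans u≺b b≺w) w≺c)
                                (<⇒≤ (<-trans u≺b b≺w)) (<⇒≤ w≺c) (inj₁ (a-leftmost u))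
      ...   | inj₁ wua = ⊥-elim (<-irrefl au (between-< (between-sym wua) u≢w))
      ...   | inj₂ wca = ⊥-elim (<⇒≱ (hub-twin-closer u-hub au cc) (between-≤ (between-sym wca)))

      x≺w = C-before-w cx
      u≺x = <-≤-trans u≺b (b-next (C-beyond cx))

      bx<bu : d b x < d b u
      bx<bu with chord-geodesic (proj₁ (u-hub cx)) u≺x (<⇒≤ u≺b) (b-next (C-beyond cx)) (inj₂ (<⇒≤ x≺w))
      ... | inj₁ buw = ⊥-elim (<-irrefl bu (between-< buw u≢w))
      ... | inj₂ bxw = subst (d b x <_) (sym bu) (between-< bxw (≺⇒≢ x≺w))

      bu≤bx : d b u ≤ d b x
      bu≤bx with C-partner cx
      ... | y , cy , x≢y with <-cmp (pos y) (pos x)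
      ...   | tri≈ _ eq _  = ⊥-elim (x≢y (sym (pos-injective eq)))
      ...   | tri> _ _ x≺y = ⊥-elim (noncrossing u y x w (proj₁ (u-hub cy)) (Adj-sym G w~x) u≺x x≺y (C-before-w cy))
      ...   | tri< y≺x _ _ with chord-geodesic (proj₁ (u-hub cy)) (<-≤-trans u≺b (b-next (C-beyond cy)))
                                  (<⇒≤ u≺b) (b-next (C-beyond cy)) (inj₂ (<⇒≤ y≺x))
      ...     | inj₁ bux = <⇒≤ (between-< bux (≺⇒≢ u≺x))
      ...     | inj₂ byx = ≤-trans (dist-step b (Adj-sym G (proj₁ (u-hub cy)))) (between-< byx (x≢y ∘ sym))

    ¬twin-before-b : ∀ {u w} → u ≺ b → u ≢ w → ClosedNbhd G C u → ClosedNbhd G C w →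
                     d a u ≡ d a w → d b u ≡ d b w → ⊥
    ¬twin-before-b {w = w} u≺b u≢w u-near (x , cx , x-w) au bu = by-position (<-cmp (pos w) (pos b))
      where
      u-hub = near∧≼p⇒hub u-near (before-b⇒≼p u≺b)

      w~x : Adj G w x
      w~x = [ (λ x≡w → ⊥-elim (<-irrefl (cong (d a) (sym x≡w)) (hub-twin-closer u-hub au cx)))
            , Adj-sym G ]′ x-w

      by-position : Tri (w ≺ b) (pos w ≡ pos b) (b ≺ w) → ⊥
      by-position (tri< w≺b _ _) =
        let w-hub = near∧≼p⇒hub (x , cx , inj₂ (Adj-sym G w~x)) (before-b⇒≼p w≺b)
            y , cy , x≢y = C-partner cx
        in no-K₂,₂-across (proj₁ (u-hub cx)) (proj₁ (u-hub cy)) (proj₁ (w-hub cx)) (proj₁ (w-hub cy))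
                          u≢w x≢y (before-b⇒≼p u≺b) (before-b⇒≼p w≺b) (C-beyond cx) (C-beyond cy)
      by-position (tri≈ _ eq _)  = equidistant-≢ (sym bu) (u≢w ∘ sym) (sym (pos-injective eq))
      by-position (tri> _ _ b≺w) = ¬hub-twin-beyond-b u≺b b≺w u-hub cx w~x au bu u≢w

    twins-beyond-b : ∀ {u w} → u ≢ w → ClosedNbhd G C u → ClosedNbhd G C w →
                     d a u ≡ d a w → d b u ≡ d b w → b ≺ u
    twins-beyond-b {u} u≢w u-near w-near au bu with <-cmp (pos u) (pos b)
    ... | tri> _ _ b≺u = b≺u
    ... | tri≈ _ eq _  = ⊥-elim (equidistant-≢ bu u≢w (sym (pos-injective eq)))
    ... | tri< u≺b _ _ = ⊥-elim (¬twin-before-b u≺b u≢w u-near w-near au bu)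

minimiser : ∀ {n} {P : Fin n → Set} → (∀ y → Dec (P y)) → (f : Fin n → ℕ) →
            ∀ {y} → P y → ∃ λ m → P m × ∀ {z} → P z → f m ≤ f z
minimiser {P = P} P? f {y} py = go py (<-wellFounded (f y))
  where
  go : ∀ {y} → P y → Acc _<_ (f y) → ∃ λ m → P m × ∀ {z} → P z → f m ≤ f z
  go {y} py (acc smaller) with any? (λ z → P? z ×-dec f z <? f y)
  ... | yes (z , pz , fz<fy) = go pz (smaller fz<fy)
  ... | no none              = y , py , λ {z} pz → ≮⇒≥ (λ fz<fy → none (z , pz , fz<fy))

module CircularOrder {m} (pos : Fin (suc m) → ℕ) where

  -- Opaque: unfolding these during unification makes type checking very slow.
  opaque
    leftmost : Fin (suc m)
    leftmost = proj₁ (minimiser (λ _ → yes tt) pos {fzero} tt)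

    leftmost-≤ : ∀ v → pos leftmost ≤ pos v
    leftmost-≤ v = proj₂ (proj₂ (minimiser (λ _ → yes tt) pos {fzero} tt)) tt

    successor : Fin (suc m) → Fin (suc m)
    successor x with any? (λ y → pos x <? pos y)
    ... | yes (_ , x≺y) = proj₁ (minimiser (λ y → pos x <? pos y) pos x≺y)
    ... | no _          = x

    successor-≥ : ∀ x → pos x ≤ pos (successor x)
    successor-≥ x with any? (λ y → pos x <? pos y)
    ... | yes (_ , x≺y) = <⇒≤ (proj₁ (proj₂ (minimiser (λ y → pos x <? pos y) pos x≺y)))
    ... | no _          = ≤-refl

    successor-next : ∀ {x y} → pos x < pos y →
                     pos x < pos (successor x) × (∀ {z} → pos x < pos z → pos (successor x) ≤ pos z)
    successor-next {x} {y} x≺y with any? (λ y → pos x <? pos y)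
    ... | yes (_ , x≺y′) = proj₂ (minimiser (λ y → pos x <? pos y) pos x≺y′)
    ... | no none        = ⊥-elim (none (y , x≺y))

  enum : ℕ → Fin (suc m)
  enum zero    = leftmost
  enum (suc i) = successor (enum i)

  enum-mono : ∀ {i j} → i ≤ j → pos (enum i) ≤ pos (enum j)
  enum-mono {j = zero} z≤n = ≤-refl
  enum-mono {j = suc j} i≤1+j with m≤n⇒m<n∨m≡n i≤1+j
  ... | inj₂ refl = ≤-refl
  ... | inj₁ i<1+j = ≤-trans (enum-mono (m<1+n⇒m≤n i<1+j)) (successor-≥ (enum j))

  -- Were some vertex beyond enum m, then enum 0, …, enum (m + 1) would be strictly increasing,
  -- i.e. m + 2 distinct vertices.
  enum-last : ∀ e → ¬ (pos (enum m) < pos e)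
  enum-last e last<e =
    let i , j , i<j , same = pigeonhole (n<1+n (suc m)) (enum ∘ toℕ)
    in <-irrefl (cong pos same) (strict i<j (m<1+n⇒m≤n (toℕ<n j)))
    where
    strict : ∀ {i j} → i < j → j ≤ suc m → pos (enum i) < pos (enum j)
    strict {i} {suc j} (s≤s i≤j) (s≤s j≤m) =
      ≤-<-trans (enum-mono i≤j) (proj₁ (successor-next (≤-<-trans (enum-mono j≤m) last<e)))

module Localisation {n k} (G : Graph n) (probes : ℕ → Vec (Fin n) k) where

  strategy : CopStrategy n k
  strategy t _ = probes t

  answer : ℕ → Fin n → Vec ℕ k
  answer t v = mapᵛ (λ c → dist G c v) (probes t)

  Candidate : (ℕ → Fin n) → ℕ → Fin n → Set
  Candidate w zero    v = answer 0 v ≡ answer 0 (w 0)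
  Candidate w (suc t) v = answer (suc t) v ≡ answer (suc t) (w (suc t)) × ClosedNbhd G (Candidate w t) v

  candidate? : ∀ w t v → Dec (Candidate w t v)
  candidate? w zero    v = ≡-decᵛ _≟ℕ_ (answer 0 v) (answer 0 (w 0))
  candidate? w (suc t) v = ≡-decᵛ _≟ℕ_ (answer (suc t) v) (answer (suc t) (w (suc t)))
                     ×-dec any? (λ x → candidate? w t x ×-dec (x ≟ v ⊎-dec adj G x v ≟ᵇ true))

  candidate-answer : ∀ {w} t {v} → Candidate w t v → answer t v ≡ answer t (w t)
  candidate-answer zero    c = c
  candidate-answer (suc t) c = proj₁ c

  candidate-self : (w : RobberWalk G) → ∀ t → Candidate (proj₁ w) t (proj₁ w t)
  candidate-self w zero    = refl
  candidate-self w (suc t) = refl , proj₁ w t , candidate-self w t , ⊎-map₁ sym (proj₂ w t)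

  same-answers⇒candidate : ∀ {w} (w′ : RobberWalk G) t →
    answers G strategy (proj₁ w′) (suc t) ≡ answers G strategy w (suc t) → Candidate w t (proj₁ w′ t)
  same-answers⇒candidate w′ zero    eq = ∷ʳ-injectiveʳ [] [] eq
  same-answers⇒candidate w′ (suc t) eq =
    let earlier , last = ∷ʳ-injective _ _ eq
    in last , proj₁ w′ t , same-answers⇒candidate w′ t earlier , ⊎-map₁ sym (proj₂ w′ t)

  Located : (ℕ → Fin n) → ℕ → Set
  Located w t = ∀ v → Candidate w t v → v ≡ w t

  Ambiguous : (ℕ → Fin n) → ℕ → Set
  Ambiguous w t = ∃ λ v → Candidate w t v × v ≢ w t

  located-or-ambiguous : ∀ w t → Located w t ⊎ Ambiguous w t
  located-or-ambiguous w t with any? (λ v → candidate? w t v ×-dec ¬? (v ≟ w t))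
  ... | yes ambiguous = inj₂ ambiguous
  ... | no unambiguous = inj₁ λ v cv → decidable-stable (v ≟ w t) (λ v≢ → unambiguous (v , cv , v≢))

  Located⇒LocatedAfter : ∀ (w : RobberWalk G) t → Located (proj₁ w) t →
                         LocatedAfter G strategy (proj₁ w) (suc t)
  Located⇒LocatedAfter w t located w′ eq = located (proj₁ w′ t) (same-answers⇒candidate w′ t eq)

  ambiguous⇒partner : ∀ (w : RobberWalk G) {t} → Ambiguous (proj₁ w) t →
                      ∀ {e} → Candidate (proj₁ w) t e → ∃ λ e′ → Candidate (proj₁ w) t e′ × e ≢ e′
  ambiguous⇒partner w {t} (v , cv , v≢wt) {e} ce with e ≟ v
  ... | yes refl = proj₁ w t , candidate-self w t , v≢wt
  ... | no e≢v   = v , cv , e≢v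

module OuterplanarStrategy {k} (G : Graph (suc (suc k))) (connected : ∀ u v → ∃ (Walk G u v))
  (pos : Fin (suc (suc k)) → ℕ) (pos-injective : Injective _≡_ _≡_ pos)
  (noncrossing : ∀ a b c e → Adj G a b → Adj G c e → pos a < pos c → pos c < pos b → pos b < pos e → ⊥)
  where

  open Distance G connected
  open Outerplanarity G connected pos pos-injective noncrossing
  open CircularOrder pos
  open Localisation G (λ t → leftmost ∷ enum (suc t) ∷ []) public

  candidate-twins : ∀ {w t x y} → Candidate w t x → Candidate w t y →
                    d leftmost x ≡ d leftmost y × d (enum (suc t)) x ≡ d (enum (suc t)) y
  candidate-twins {t = t} cx cy =
    let eq₁ , rest = ∷-injective (trans (candidate-answer t cx) (sym (candidate-answer t cy)))
    in eq₁ , proj₁ (∷-injective rest)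

  Progress : RobberWalk G → ℕ → Set
  Progress w t = (∃ λ s → s ≤ t × Located (proj₁ w) s) ⊎
                 (Ambiguous (proj₁ w) t × ∀ {e} → Candidate (proj₁ w) t e → enum (suc t) ≺ e)

  twin-beyond-successor : ∀ {p e e′} → p ≺ e → d (successor p) e ≡ d (successor p) e′ → e ≢ e′ →
                          successor p ≺ e
  twin-beyond-successor p≺e eq e≢e′ = ≼∧≢⇒≺ (proj₂ (successor-next p≺e) p≺e) (equidistant-≢ eq e≢e′)

  progress-zero : ∀ w → Progress w 0
  progress-zero w with located-or-ambiguous (proj₁ w) 0
  ... | inj₁ located   = inj₁ (0 , z≤n , located)
  ... | inj₂ ambiguous = inj₂ (ambiguous , beyond)
    where
    beyond : ∀ {e} → Candidate (proj₁ w) 0 e → enum 1 ≺ e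
    beyond {e} ce =
      let e′ , ce′ , e≢e′ = ambiguous⇒partner w ambiguous ce
          twin-a , twin-1 = candidate-twins {proj₁ w} ce ce′
      in twin-beyond-successor (≼∧≢⇒≺ (leftmost-≤ e) (equidistant-≢ twin-a e≢e′)) twin-1 e≢e′

  progress-suc : ∀ w t → Progress w t → Progress w (suc t)
  progress-suc w t (inj₁ (s , s≤t , located)) = inj₁ (s , m≤n⇒m≤1+n s≤t , located)
  progress-suc w t (inj₂ (ambiguous , beyond)) with located-or-ambiguous (proj₁ w) (suc t)
  ... | inj₁ located    = inj₁ (suc t , ≤-refl , located)
  ... | inj₂ ambiguous′ = inj₂ (ambiguous′ , beyond′)
    where
    open CandidateStep leftmost (enum (suc t)) (enum (suc (suc t))) leftmost-≤
      (proj₂ (successor-next (beyond (candidate-self w t)))) (Candidate (proj₁ w) t) beyond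
      (λ cx cy → proj₁ (candidate-twins {proj₁ w} cx cy)) (λ cx cy → proj₂ (candidate-twins {proj₁ w} cx cy))
      (ambiguous⇒partner w ambiguous)
    beyond′ : ∀ {e} → Candidate (proj₁ w) (suc t) e → enum (suc (suc t)) ≺ e
    beyond′ ce =
      let e′ , ce′ , e≢e′ = ambiguous⇒partner w ambiguous′ ce
          twin-a , twin-b = candidate-twins {proj₁ w} ce ce′
      in twins-beyond-b e≢e′ (proj₂ ce) (proj₂ ce′) twin-a twin-b

  progress : ∀ w t → Progress w t
  progress w zero    = progress-zero w
  progress w (suc t) = progress-suc w t (progress w t)

  locates : ∀ w → ∃ λ s → s ≤ k × Located (proj₁ w) s
  locates w with progress w k
  ... | inj₁ found = found
  ... | inj₂ (_ , beyond) = ⊥-elim (enum-last (proj₁ w k) (beyond (candidate-self w k)))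

LcaptAtMost-mono : ∀ {n} {G : Graph n} {k N N′} → N ≤ N′ → LcaptAtMost G k N → LcaptAtMost G k N′
LcaptAtMost-mono N≤N′ (σ , wins) = σ , λ w → let t , t≤N , located = wins w in t , ≤-trans t≤N N≤N′ , located

lcapt-single-vertex : ∀ (G : Graph 1) k → LcaptAtMost G k 0
lcapt-single-vertex G k = (λ _ _ → replicateᵛ k fzero) , λ w → 0 , z≤n , λ w′ → unique (proj₁ w′ 0) (proj₁ w 0)
  where unique : (x y : Fin 1) → x ≡ y
        unique fzero fzero = refl

lcapt₂-outerplanar : ∀ {k} (G : Graph (suc (suc k))) → Connected G → Outerplanar G → LcaptAtMost G 2 (suc k)
lcapt₂-outerplanar G connected (pos , pos-injective , noncrossing) =
  strategy , λ w → let s , s≤k , located = locates w in suc s , s≤s s≤k , Located⇒LocatedAfter w s located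
  where open OuterplanarStrategy G (Connected⇒walks connected) pos pos-injective noncrossing

∣p∪q∣≤∣p∣+∣q∣ : ∀ {n} (p q : Subset n) → ∣ p ∪ q ∣ ≤ ∣ p ∣ + ∣ q ∣
∣p∪q∣≤∣p∣+∣q∣ []            []            = z≤n
∣p∪q∣≤∣p∣+∣q∣ (outside ∷ p) (outside ∷ q) = ∣p∪q∣≤∣p∣+∣q∣ p q
∣p∪q∣≤∣p∣+∣q∣ (outside ∷ p) (inside  ∷ q) =
  ≤-trans (s≤s (∣p∪q∣≤∣p∣+∣q∣ p q)) (≤-reflexive (sym (+-suc ∣ p ∣ ∣ q ∣)))
∣p∪q∣≤∣p∣+∣q∣ (inside  ∷ p) (outside ∷ q) = s≤s (∣p∪q∣≤∣p∣+∣q∣ p q)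
∣p∪q∣≤∣p∣+∣q∣ (inside  ∷ p) (inside  ∷ q) =
  s≤s (≤-trans (m≤n⇒m≤1+n (∣p∪q∣≤∣p∣+∣q∣ p q)) (≤-reflexive (sym (+-suc ∣ p ∣ ∣ q ∣))))

∣p∪q∣<∣p∣+∣q∣ : ∀ {n} (p q : Subset n) {x} → x ∈ p → x ∈ q → ∣ p ∪ q ∣ < ∣ p ∣ + ∣ q ∣
∣p∪q∣<∣p∣+∣q∣ (inside  ∷ p) (inside  ∷ q) here        here        =
  s≤s (≤-trans (s≤s (∣p∪q∣≤∣p∣+∣q∣ p q)) (≤-reflexive (sym (+-suc ∣ p ∣ ∣ q ∣))))
∣p∪q∣<∣p∣+∣q∣ (outside ∷ p) (outside ∷ q) (there x∈p) (there x∈q) = ∣p∪q∣<∣p∣+∣q∣ p q x∈p x∈q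
∣p∪q∣<∣p∣+∣q∣ (outside ∷ p) (inside  ∷ q) (there x∈p) (there x∈q) =
  ≤-trans (s≤s (∣p∪q∣<∣p∣+∣q∣ p q x∈p x∈q)) (≤-reflexive (sym (+-suc ∣ p ∣ ∣ q ∣)))
∣p∪q∣<∣p∣+∣q∣ (inside  ∷ p) (outside ∷ q) (there x∈p) (there x∈q) = s≤s (∣p∪q∣<∣p∣+∣q∣ p q x∈p x∈q)
∣p∪q∣<∣p∣+∣q∣ (inside  ∷ p) (inside  ∷ q) (there x∈p) (there x∈q) =
  s≤s (≤-trans (m≤n⇒m≤1+n (∣p∪q∣<∣p∣+∣q∣ p q x∈p x∈q)) (≤-reflexive (sym (+-suc ∣ p ∣ ∣ q ∣))))

⊆∧⊈⇒⊂ : ∀ {n} {S T : Subset n} → S ⊆ T → ¬ T ⊆ S → S ⊂ T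
⊆∧⊈⇒⊂ {S = S} {T} S⊆T T⊈S with any? (λ x → x ∈? T ×-dec ¬? (x ∈? S))
... | yes (x , x∈T , x∉S) = S⊆T , x , x∈T , x∉S
... | no none = ⊥-elim (T⊈S λ {x} x∈T → decidable-stable (x ∈? S) (λ x∉S → none (x , x∈T , x∉S)))

∈－⇒≢ : ∀ {n} {S : Subset n} {c x} → x ∈ S － c → x ∈ S × x ≢ c
∈－⇒≢ {S = _ ∷ S} {fzero}  {fsuc x} (there x∈) = there x∈ , λ ()
∈－⇒≢ {S = _ ∷ S} {fsuc c} {fzero}  here       = here , λ ()
∈－⇒≢ {S = _ ∷ S} {fsuc c} {fsuc x} (there x∈) =
  let x∈S , x≢c = ∈－⇒≢ {S = S} x∈ in there x∈S , x≢c ∘ fsuc-injective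

sum-mono : ∀ {A : Set} {f g : A → ℕ} → (∀ x → f x ≤ g x) → ∀ xs → sum (mapˡ f xs) ≤ sum (mapˡ g xs)
sum-mono f≤g []       = z≤n
sum-mono f≤g (x ∷ xs) = +-mono-≤ (f≤g x) (sum-mono f≤g xs)

sum-mono-at : ∀ {A : Set} {f g : A → ℕ} {x δ} → (∀ x → f x ≤ g x) → f x + δ ≤ g x →
              ∀ {xs} → x ∈ˡ xs → sum (mapˡ f xs) + δ ≤ sum (mapˡ g xs)
sum-mono-at {f = f} {g} {x} {δ} f≤g gap {x ∷ xs} (here refl) = begin
  f x + sum (mapˡ f xs) + δ ≡⟨ +-assoc (f x) _ δ ⟩
  f x + (sum (mapˡ f xs) + δ) ≡⟨ cong (f x +_) (+-comm _ δ) ⟩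
  f x + (δ + sum (mapˡ f xs)) ≡⟨ +-assoc (f x) δ _ ⟨
  f x + δ + sum (mapˡ f xs) ≤⟨ +-mono-≤ gap (sum-mono f≤g xs) ⟩
  g x + sum (mapˡ g xs) ∎
  where open ≤-Reasoning
sum-mono-at {f = f} {g} {δ = δ} f≤g gap {y ∷ xs} (there x∈xs) = begin
  f y + sum (mapˡ f xs) + δ ≡⟨ +-assoc (f y) _ δ ⟩
  f y + (sum (mapˡ f xs) + δ) ≤⟨ +-mono-≤ (f≤g y) (sum-mono-at f≤g gap x∈xs) ⟩
  g y + sum (mapˡ g xs) ∎
  where open ≤-Reasoning

module _ {n} (G : Graph n) where

  walk-exit : ∀ {R a y k} → Walk G a y k → a ∈ R → y ∉ R → ∃₂ λ u v → u ∈ R × v ∉ R × Adj G u v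
  walk-exit nil a∈R y∉R = ⊥-elim (y∉R a∈R)
  walk-exit {R} (_▷_ {w} p e) a∈R y∉R with w ∈? R
  ... | yes w∈R = w , _ , w∈R , y∉R , e
  ... | no w∉R  = walk-exit p a∈R w∉R

  edge-TwoConnLike : ∀ {u v} → Adj G u v → TwoConnLike G (⁅ u ⁆ ∪ ⁅ v ⁆)
  edge-TwoConnLike {u} {v} u~v = ((u , u∈) , connected) , no-cut
    where
    u∈ : u ∈ ⁅ u ⁆ ∪ ⁅ v ⁆
    u∈ = x∈p∪q⁺ (inj₁ (x∈⁅x⁆ u))

    endpoint : ∀ {x} → x ∈ ⁅ u ⁆ ∪ ⁅ v ⁆ → x ≡ u ⊎ x ≡ v
    endpoint x∈ = ⊎-map (x∈⁅y⁆⇒x≡y u) (x∈⁅y⁆⇒x≡y v) (x∈p∪q⁻ ⁅ u ⁆ ⁅ v ⁆ x∈)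

    connected : ∀ a b → a ∈ ⁅ u ⁆ ∪ ⁅ v ⁆ → b ∈ ⁅ u ⁆ ∪ ⁅ v ⁆ → ReachIn G (⁅ u ⁆ ∪ ⁅ v ⁆) a b
    connected a b a∈ b∈ with endpoint a∈ | endpoint b∈
    ... | inj₁ refl | inj₁ refl = here a∈
    ... | inj₂ refl | inj₂ refl = here a∈
    ... | inj₁ refl | inj₂ refl = step a∈ u~v (here b∈)
    ... | inj₂ refl | inj₁ refl = step a∈ (Adj-sym G u~v) (here b∈)

    -- Removing a vertex leaves at most one vertex.
    no-cut : ∀ c → ¬ IsCutVertexIn G (⁅ u ⁆ ∪ ⁅ v ⁆) c
    no-cut c (c∈ , a , b , a∈ , b∈ , unreachable)
      with ∈－⇒≢ {S = ⁅ u ⁆ ∪ ⁅ v ⁆} a∈ | ∈－⇒≢ {S = ⁅ u ⁆ ∪ ⁅ v ⁆} b∈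
    ... | a∈′ , a≢c | b∈′ , b≢c with endpoint a∈′ | endpoint b∈′ | endpoint c∈
    ... | inj₁ refl | inj₁ refl | _         = unreachable (here a∈)
    ... | inj₂ refl | inj₂ refl | _         = unreachable (here a∈)
    ... | inj₁ refl | inj₂ refl | inj₁ refl = a≢c refl
    ... | inj₁ refl | inj₂ refl | inj₂ refl = b≢c refl
    ... | inj₂ refl | inj₁ refl | inj₁ refl = b≢c refl
    ... | inj₂ refl | inj₁ refl | inj₂ refl = a≢c refl

  extend-to-block : ∀ {S} → Acc _⊃_ S → TwoConnLike G S → ¬ ¬ (∃ λ T → S ⊆ T × IsBlock G T)
  extend-to-block {S} (acc larger) S-tc no-block =
    ¬¬-excluded-middle {A = ∃ λ T → S ⊂ T × TwoConnLike G T} λ where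
      (yes (T , S⊂T , T-tc)) → extend-to-block (larger S⊂T) T-tc
        λ (U , T⊆U , U-block) → no-block (U , ⊆-trans (proj₁ S⊂T) T⊆U , U-block)
      (no maximal) → no-block (S , ⊆-refl , S-tc , λ T S⊆T T-tc →
        ⊆-antisym (decidable-stable (T ⊆? S) (λ T⊈S → maximal (T , ⊆∧⊈⇒⊂ S⊆T T⊈S , T-tc))) S⊆T)

  edge-in-block : ∀ {Bs u v} → AreTheBlocks G Bs → Adj G u v → ¬ ¬ (∃ λ B → B ∈ˡ Bs × u ∈ B × v ∈ B)
  edge-in-block {Bs} {u} {v} (_ , blocks) u~v =
    ¬¬-map (λ (B , uv⊆B , B-block) → B , proj₁ (blocks B) B-block , uv⊆B (x∈p∪q⁺ (inj₁ (x∈⁅x⁆ u))) ,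
                                                                    uv⊆B (x∈p∪q⁺ (inj₂ (x∈⁅x⁆ v))))
           (extend-to-block (⊃-wellFounded _) (edge-TwoConnLike u~v))

module _ {n} (G : Graph n) (Bs : List (Subset n)) where

  innerPart : Subset n → Subset n → ℕ
  innerPart R B = if does (B ⊆? R) then ∣ B ∣ ∸ 1 else 0

  innerSum : Subset n → ℕ
  innerSum R = sum (mapˡ (innerPart R) Bs)

  innerPart-≤ : ∀ R B → innerPart R B ≤ ∣ B ∣ ∸ 1
  innerPart-≤ R B with B ⊆? R
  ... | yes _ = ≤-refl
  ... | no _  = z≤n

  innerPart-mono : ∀ {R R′} → R ⊆ R′ → ∀ B → innerPart R B ≤ innerPart R′ B
  innerPart-mono {R} {R′} R⊆R′ B with B ⊆? R | B ⊆? R′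
  ... | yes _    | yes _     = ≤-refl
  ... | yes B⊆R  | no B⊈R′   = ⊥-elim (B⊈R′ (⊆-trans B⊆R R⊆R′))
  ... | no _     | _         = z≤n

  innerPart-new : ∀ {R R′ B} → ¬ B ⊆ R → B ⊆ R′ → innerPart R B + (∣ B ∣ ∸ 1) ≤ innerPart R′ B
  innerPart-new {R} {R′} {B} B⊈R B⊆R′ with B ⊆? R | B ⊆? R′
  ... | yes B⊆R | _        = ⊥-elim (B⊈R B⊆R)
  ... | no _    | yes _    = ≤-refl
  ... | no _    | no B⊈R′  = ⊥-elim (B⊈R′ B⊆R′)

  add-block : ∀ {R B u} → ∣ R ∣ ≤ suc (innerSum R) → u ∈ R → u ∈ B → B ∈ˡ Bs → ¬ B ⊆ R →
              ∣ R ∪ B ∣ ≤ suc (innerSum (R ∪ B))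
  add-block {R} {B} R≤ u∈R u∈B B∈Bs B⊈R = ≤-pred (begin
    suc ∣ R ∪ B ∣                        ≤⟨ ∣p∪q∣<∣p∣+∣q∣ R B u∈R u∈B ⟩
    ∣ R ∣ + ∣ B ∣                        ≤⟨ +-mono-≤ R≤ (m≤n+m∸n ∣ B ∣ 1) ⟩
    suc (innerSum R) + suc (∣ B ∣ ∸ 1)   ≡⟨ cong suc (+-suc (innerSum R) (∣ B ∣ ∸ 1)) ⟩
    suc (suc (innerSum R + (∣ B ∣ ∸ 1))) ≤⟨ s≤s (s≤s (sum-mono-at (innerPart-mono (p⊆p∪q B))
                                                                  (innerPart-new B⊈R (q⊆p∪q R B)) B∈Bs)) ⟩
    suc (suc (innerSum (R ∪ B)))         ∎)
    where open ≤-Reasoning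

  vertices≤1+blockSum : Connected G → AreTheBlocks G Bs → n ≤ suc (blockSum Bs)
  vertices≤1+blockSum connected@((v₀ , _) , _) blocks =
    grow (⊃-wellFounded ⁅ v₀ ⁆) (x∈⁅x⁆ v₀) (≤-trans (≤-reflexive (∣⁅x⁆∣≡1 v₀)) (s≤s z≤n))
    where
    grow : ∀ {R} → Acc _⊃_ R → v₀ ∈ R → ∣ R ∣ ≤ suc (innerSum R) → n ≤ suc (blockSum Bs)
    grow {R} (acc larger) v₀∈R R≤ with all? (_∈? R)
    ... | yes all∈R = begin
      n                 ≡⟨ ∣⊤∣≡n n ⟨
      ∣ ⊤ {n} ∣         ≤⟨ p⊆q⇒∣p∣≤∣q∣ {p = ⊤} (λ {x} _ → all∈R x) ⟩
      ∣ R ∣             ≤⟨ R≤ ⟩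
      suc (innerSum R)  ≤⟨ s≤s (sum-mono (innerPart-≤ R) Bs) ⟩
      suc (blockSum Bs) ∎
      where open ≤-Reasoning
    ... | no ¬all∈R =
      let y , y∉R = ¬∀⟶∃¬ n _ (_∈? R) ¬all∈R
          u , v , u∈R , v∉R , u~v = walk-exit G (proj₂ (Connected⇒walks connected v₀ y)) v₀∈R y∉R
      in decidable-stable (n ≤? suc (blockSum Bs)) λ n≰ → edge-in-block G blocks u~v
           λ (B , B∈Bs , u∈B , v∈B) → n≰ (grow (larger (p⊆p∪q B , v , q⊆p∪q R B v∈B , v∉R)) (p⊆p∪q B v₀∈R)
                                            (add-block R≤ u∈R u∈B B∈Bs (λ B⊆R → v∉R (B⊆R v∈B))))

proposition3p1 : (n : ℕ) (G : Graph n) → Connected G → Outerplanar G →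
    (Bs : List (Subset n)) → AreTheBlocks G Bs →
    LcaptAtMost G 2 (blockSum Bs)
proposition3p1 zero          G ((() , _) , _) _ _ _
proposition3p1 (suc zero)    G _ _ Bs _ = LcaptAtMost-mono z≤n (lcapt-single-vertex G 2)
proposition3p1 (suc (suc k)) G connected outerplanar Bs blocks =
  LcaptAtMost-mono (≤-pred (vertices≤1+blockSum G Bs connected blocks))
                   (lcapt₂-outerplanar G connected outerplanar)
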